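{- Let $T$ be a rooted tree with nodes $\{1,\dots,n\}$, let there be $m$ tasks, and let $w_{i,j}$ be real weights. Let $\lambda$ be the set of leaves of $T$ and, for each leaf $k\in\lambda$, let $\Pi_k$ be the set of nodes on the path from the root to $k$. The LP: maximize $\sum_{i=1}^n\sum_{j=1}^m w_{i,j}x_{i,j}$ subject to $\sum_{j=1}^m x_{i,j}\le 1$ for all $i$; $\sum_{i=1}^n x_{i,j}=1$ for all $j$; $\sum_{i\in\Pi_k}\sum_{j=1}^m x_{i,j}\le 1$ for all $k\in\lambda$; and $0\le x_{i,j}\le 1$ for all $i,j$, has a (feasible) solution if and only if $|\lambda|\ge m$.
   Context: This LP is the linear programming relaxation of the integer program for the MWTM problem (assign each of $m$ tasks to distinct nodes of $T$ so that no assigned node is an ancestor of another, maximizing total weight), obtained by replacing $x_{i,j}\in\{0,1\}$ by $0\le x_{i,j}\le 1$.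
   Formalization: The weights $w_{i,j}$ and the LP variables $x_{i,j}$ take values in ℚ rather than in the reals. -}

module Defs where

open import Data.Nat using (ℕ; zero; suc)
open import Data.Fin using (Fin)
open import Data.Fin.Properties using (all?) renaming (_≟_ to _≟ᶠ_)
open import Data.List using (List; []; _∷_; map; foldr; filter; length; allFin)
open import Data.Maybe using (Maybe; just; nothing)
open import Data.Maybe.Properties using (≡-dec)
open import Data.Rational using (ℚ; 0ℚ; 1ℚ; _+_; _≤_)
open import Relation.Binary.PropositionalEquality using (_≡_; _≢_)
open import Relation.Nullary using (Dec; ¬?)

-- A rooted tree on nodes Fin n, given by a parent map
-- (parent i ≡ nothing  iff  i is a root).
-- Anc parent i j : i is an ancestor of j or i ≡ j (i lies on the root-to-j path).
data Anc {n : ℕ} (parent : Fin n → Maybe (Fin n)) (i : Fin n) : Fin n → Set where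
  here  : Anc parent i i
  there : ∀ {j p} → parent j ≡ just p → Anc parent i p → Anc parent i j

-- parent encodes a rooted tree with root r: r has no parent and every node
-- reaches r by following parents (this forces acyclicity and r the unique root).
record IsRootedTree {n : ℕ} (parent : Fin n → Maybe (Fin n)) (r : Fin n) : Set where
  field
    root-parent : parent r ≡ nothing
    reaches-root : ∀ j → Anc parent r j

Leaf : {n : ℕ} → (Fin n → Maybe (Fin n)) → Fin n → Set
Leaf parent k = ∀ j → parent j ≢ just k

leaf? : {n : ℕ} (parent : Fin n → Maybe (Fin n)) (k : Fin n) → Dec (Leaf parent k)
leaf? parent k = all? (λ j → ¬? (≡-dec _≟ᶠ_ (parent j) (just k)))

numLeaves : {n : ℕ} → (Fin n → Maybe (Fin n)) → ℕ
numLeaves {n} parent = length (filter (leaf? parent) (allFin n))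

-- nodes visited following parents from k, with fuel; with fuel n in a tree
-- on n nodes this is exactly Π_k, the root-to-k path.
pathFrom : {n : ℕ} → (Fin n → Maybe (Fin n)) → ℕ → Fin n → List (Fin n)
pathFrom parent zero k = []
pathFrom parent (suc f) k with parent k
... | nothing = k ∷ []
... | just p  = k ∷ pathFrom parent f p

Π : {n : ℕ} → (Fin n → Maybe (Fin n)) → Fin n → List (Fin n)
Π {n} parent k = pathFrom parent n k

sumℚ : List ℚ → ℚ
sumℚ = foldr _+_ 0ℚ

Σ[_] : (n : ℕ) → (Fin n → ℚ) → ℚ
Σ[ n ] f = sumℚ (map f (allFin n))

record Feasible {n m : ℕ} (parent : Fin n → Maybe (Fin n)) (x : Fin n → Fin m → ℚ) : Set where
  field
    node-cap  : ∀ i → Σ[ m ] (x i) ≤ 1ℚ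
    task-once : ∀ j → Σ[ n ] (λ i → x i j) ≡ 1ℚ
    path-cap  : ∀ k → Leaf parent k → sumℚ (map (λ i → Σ[ m ] (x i)) (Π parent k)) ≤ 1ℚ
    lower     : ∀ i j → 0ℚ ≤ x i j
    upper     : ∀ i j → x i j ≤ 1ℚ

-- Double counting gives the necessity of |λ| ≥ m: every node lies on some
-- root-to-leaf path, so the total load m = Σᵢ Σⱼ xᵢⱼ is at most the sum, over
-- the leaves k, of the load on Π_k, and each of those is at most 1.
-- Conversely, if |λ| ≥ m, assigning the tasks to distinct leaves is feasible,
-- since a root-to-leaf path contains exactly one leaf.

module Submission where

open import Defs
open import Algebra.Bundles using (CommutativeMonoid)
open import Data.Empty using (⊥-elim)
open import Data.Fin using (Fin; zero; suc; toℕ; inject≤)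
import Data.Fin.Properties as Fin
open import Data.List using (List; []; _∷_; map; filter; length; allFin; lookup)
import Data.List.Properties as List
open import Data.List.Membership.Propositional using (_∈_)
open import Data.List.Membership.Propositional.Properties
  using (∈-filter⁺; ∈-filter⁻; ∈-allFin; ∈-lookup)
open import Data.List.Relation.Unary.All as All using ()
open import Data.List.Relation.Unary.AllPairs using (_∷_)
open import Data.List.Relation.Unary.Any using (here; there; any?)
open import Data.List.Relation.Unary.Unique.Propositional using (Unique)
open import Data.List.Relation.Unary.Unique.Propositional.Properties
  using (filter⁺; allFin⁺)
open import Data.Maybe using (Maybe; just; nothing)
open import Data.Maybe.Properties using (≡-dec)
open import Data.Nat using (ℕ; zero; suc; _≥_; z≤n; s≤s)
import Data.Nat as ℕ
import Data.Nat.Properties as ℕ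
open import Data.Product using (∃; Σ; _×_; _,_; proj₂)
open import Data.Rational using (ℚ; 0ℚ; 1ℚ; _+_; _≤_; _<_)
import Data.Rational.Properties as ℚ
open import Function using (_∘_; id)
open import Function.Bundles using (_⇔_; mk⇔)
open import Function.Definitions using (Injective)
open import Relation.Binary.PropositionalEquality
open import Relation.Nullary using (Dec; yes; no; ¬_; ¬?)
open import Relation.Nullary.Decidable using (decidable-stable)

open import Algebra.Properties.CommutativeSemigroup
  (CommutativeMonoid.commutativeSemigroup ℚ.+-0-commutativeMonoid) using (interchange)

0≤1 : 0ℚ ≤ 1ℚ
0≤1 = ℚ.nonNegative⁻¹ 1ℚ

p≤p+q : ∀ {p q} → 0ℚ ≤ q → p ≤ p + q
p≤p+q {p} {q} 0≤q = ℚ.≤-trans (ℚ.≤-reflexive (sym (ℚ.+-identityʳ p))) (ℚ.+-monoʳ-≤ p 0≤q)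

p≤q+p : ∀ {p q} → 0ℚ ≤ q → p ≤ q + p
p≤q+p {p} {q} 0≤q = ℚ.≤-trans (p≤p+q 0≤q) (ℚ.≤-reflexive (ℚ.+-comm p q))

module _ {A : Set} where

  sum-map-cong : (l : List A) {f g : A → ℚ} → (∀ a → f a ≡ g a) →
                 sumℚ (map f l) ≡ sumℚ (map g l)
  sum-map-cong l f≗g = cong sumℚ (List.map-cong f≗g l)

  sum-map-mono : (l : List A) {f g : A → ℚ} → (∀ a → f a ≤ g a) →
                 sumℚ (map f l) ≤ sumℚ (map g l)
  sum-map-mono []      f≤g = ℚ.≤-refl
  sum-map-mono (a ∷ l) f≤g = ℚ.+-mono-≤ (f≤g a) (sum-map-mono l f≤g)

  sum-map-distrib-+ : (l : List A) (f g : A → ℚ) →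
                      sumℚ (map (λ a → f a + g a) l) ≡ sumℚ (map f l) + sumℚ (map g l)
  sum-map-distrib-+ []      f g = sym (ℚ.+-identityʳ 0ℚ)
  sum-map-distrib-+ (a ∷ l) f g =
    trans (cong ((f a + g a) +_) (sum-map-distrib-+ l f g)) (interchange (f a) (g a) _ _)

  sum-map-0 : (l : List A) {f : A → ℚ} → (∀ a → f a ≡ 0ℚ) → sumℚ (map f l) ≡ 0ℚ
  sum-map-0 []      f≡0 = refl
  sum-map-0 (a ∷ l) f≡0 = trans (cong₂ _+_ (f≡0 a) (sum-map-0 l f≡0)) (ℚ.+-identityʳ 0ℚ)

  sum-map-nonNeg : (l : List A) {f : A → ℚ} → (∀ a → 0ℚ ≤ f a) → 0ℚ ≤ sumℚ (map f l)
  sum-map-nonNeg []      0≤f = ℚ.≤-refl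
  sum-map-nonNeg (a ∷ l) 0≤f = ℚ.≤-trans (0≤f a) (p≤p+q (sum-map-nonNeg l 0≤f))

  ∈⇒≤-sum-map : {l : List A} (f : A → ℚ) → (∀ a → 0ℚ ≤ f a) →
                ∀ {a} → a ∈ l → f a ≤ sumℚ (map f l)
  ∈⇒≤-sum-map {b ∷ l} f 0≤f (here refl) = p≤p+q (sum-map-nonNeg l 0≤f)
  ∈⇒≤-sum-map {b ∷ l} f 0≤f (there a∈l) = ℚ.≤-trans (∈⇒≤-sum-map f 0≤f a∈l) (p≤q+p (0≤f b))

sum-map-comm : {A B : Set} (la : List A) (lb : List B) (f : A → B → ℚ) →
               sumℚ (map (λ a → sumℚ (map (f a) lb)) la) ≡
               sumℚ (map (λ b → sumℚ (map (λ a → f a b) la)) lb)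
sum-map-comm []       lb f = sym (sum-map-0 lb (λ _ → refl))
sum-map-comm (a ∷ la) lb f =
  trans (cong (sumℚ (map (f a) lb) +_) (sum-map-comm la lb f))
        (sym (sum-map-distrib-+ lb (f a) (λ b → sumℚ (map (λ a → f a b) la))))

Σ-suc : ∀ n (f : Fin (suc n) → ℚ) → Σ[ suc n ] f ≡ f zero + Σ[ n ] (f ∘ suc)
Σ-suc n f = cong (f zero +_) (cong sumℚ
  (trans (List.map-tabulate suc f) (sym (List.map-tabulate id (f ∘ suc)))))

fromℕ : ℕ → ℚ
fromℕ zero    = 0ℚ
fromℕ (suc k) = 1ℚ + fromℕ k

fromℕ-nonNeg : ∀ k → 0ℚ ≤ fromℕ k
fromℕ-nonNeg zero    = ℚ.≤-refl
fromℕ-nonNeg (suc k) = ℚ.≤-trans (fromℕ-nonNeg k) (p≤q+p 0≤1)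

fromℕ-mono-< : ∀ {a b} → a ℕ.< b → fromℕ a < fromℕ b
fromℕ-mono-< {zero}  {suc b} _         = ℚ.+-mono-<-≤ (ℚ.positive⁻¹ 1ℚ) (fromℕ-nonNeg b)
fromℕ-mono-< {suc a} {suc b} (s≤s a<b) = ℚ.+-mono-≤-< (ℚ.≤-refl {1ℚ}) (fromℕ-mono-< a<b)

fromℕ-cancel-≤ : ∀ {a b} → fromℕ a ≤ fromℕ b → a ℕ.≤ b
fromℕ-cancel-≤ {a} {b} fa≤fb with a ℕ.≤? b
... | yes a≤b = a≤b
... | no  a≰b = ⊥-elim (ℚ.<-irrefl refl (ℚ.<-≤-trans (fromℕ-mono-< (ℕ.≰⇒> a≰b)) fa≤fb))

sum-map-≤1 : {A : Set} (l : List A) (f : A → ℚ) → (∀ {a} → a ∈ l → f a ≤ 1ℚ) →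
             sumℚ (map f l) ≤ fromℕ (length l)
sum-map-≤1 []      f f≤1 = ℚ.≤-refl
sum-map-≤1 (a ∷ l) f f≤1 = ℚ.+-mono-≤ (f≤1 (here refl)) (sum-map-≤1 l f (f≤1 ∘ there))

Σ-const-1 : ∀ m → Σ[ m ] (λ _ → 1ℚ) ≡ fromℕ m
Σ-const-1 zero    = refl
Σ-const-1 (suc m) = trans (Σ-suc m (λ _ → 1ℚ)) (cong (1ℚ +_) (Σ-const-1 m))

indicator : {P : Set} → Dec P → ℚ → ℚ
indicator (yes _) q = q
indicator (no  _) q = 0ℚ

module _ {P : Set} where

  indicator-yes : (d : Dec P) {q : ℚ} → P → indicator d q ≡ q
  indicator-yes (yes _) p = refl
  indicator-yes (no ¬p) p = ⊥-elim (¬p p)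

  indicator-no : (d : Dec P) {q : ℚ} → ¬ P → indicator d q ≡ 0ℚ
  indicator-no (yes p) ¬p = ⊥-elim (¬p p)
  indicator-no (no  _) ¬p = refl

  indicator-nonNeg : (d : Dec P) {q : ℚ} → 0ℚ ≤ q → 0ℚ ≤ indicator d q
  indicator-nonNeg (yes _) 0≤q = 0≤q
  indicator-nonNeg (no  _) 0≤q = ℚ.≤-refl

  indicator-≤ : (d : Dec P) {q : ℚ} → 0ℚ ≤ q → indicator d q ≤ q
  indicator-≤ (yes _) 0≤q = ℚ.≤-refl
  indicator-≤ (no  _) 0≤q = 0≤q

  indicator-cong : {Q : Set} (d : Dec P) (e : Dec Q) {q : ℚ} →
                   (P → Q) → (Q → P) → indicator d q ≡ indicator e q
  indicator-cong (yes p) (yes q) P⇒Q Q⇒P = refl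
  indicator-cong (yes p) (no ¬q) P⇒Q Q⇒P = ⊥-elim (¬q (P⇒Q p))
  indicator-cong (no ¬p) (yes q) P⇒Q Q⇒P = ⊥-elim (¬p (Q⇒P q))
  indicator-cong (no ¬p) (no ¬q) P⇒Q Q⇒P = refl

_∈?_ : ∀ {n} (i : Fin n) (l : List (Fin n)) → Dec (i ∈ l)
i ∈? l = any? (i Fin.≟_) l

Σ-indicator-≡ : ∀ n (x : Fin n) (f : Fin n → ℚ) →
                Σ[ n ] (λ i → indicator (i Fin.≟ x) (f i)) ≡ f x
Σ-indicator-≡ (suc n) zero f =
  trans (Σ-suc n (λ i → indicator (i Fin.≟ zero) (f i)))
  (trans (cong (f zero +_) (sum-map-0 (allFin n) (λ i → indicator-no (suc i Fin.≟ zero) {f (suc i)} λ ())))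
         (ℚ.+-identityʳ (f zero)))
Σ-indicator-≡ (suc n) (suc x) f =
  trans (Σ-suc n (λ i → indicator (i Fin.≟ suc x) (f i)))
  (trans (ℚ.+-identityˡ _)
  (trans (sum-map-cong (allFin n)
           (λ i → indicator-cong (suc i Fin.≟ suc x) (i Fin.≟ x) {f (suc i)} Fin.suc-injective (cong suc)))
         (Σ-indicator-≡ n x (f ∘ suc))))

-- Duplicates in l are counted once on the left and repeatedly on the right.
Σ-indicator-∈≤sum-map : ∀ n (s : Fin n → ℚ) → (∀ i → 0ℚ ≤ s i) → (l : List (Fin n)) →
                        Σ[ n ] (λ i → indicator (i ∈? l) (s i)) ≤ sumℚ (map s l)
Σ-indicator-∈≤sum-map n s 0≤s [] =
  ℚ.≤-reflexive (sum-map-0 (allFin n) (λ i → indicator-no (i ∈? []) {s i} λ ()))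
Σ-indicator-∈≤sum-map n s 0≤s (x ∷ l) = ℚ.≤-trans
  (sum-map-mono (allFin n) indicator-∷≤)
  (ℚ.≤-trans
    (ℚ.≤-reflexive (sum-map-distrib-+ (allFin n) (λ i → indicator (i Fin.≟ x) (s i)) _))
    (ℚ.+-mono-≤ (ℚ.≤-reflexive (Σ-indicator-≡ n x s)) (Σ-indicator-∈≤sum-map n s 0≤s l)))
  where
  indicator-∷≤ : ∀ i → indicator (i ∈? (x ∷ l)) (s i) ≤
                       indicator (i Fin.≟ x) (s i) + indicator (i ∈? l) (s i)
  indicator-∷≤ i = split (i ∈? (x ∷ l))
    where
    split : (d : Dec (i ∈ x ∷ l)) →
            indicator d (s i) ≤ indicator (i Fin.≟ x) (s i) + indicator (i ∈? l) (s i)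
    split (no _) = ℚ.≤-trans (ℚ.≤-reflexive (sym (ℚ.+-identityʳ 0ℚ)))
      (ℚ.+-mono-≤ (indicator-nonNeg (i Fin.≟ x) (0≤s i)) (indicator-nonNeg (i ∈? l) (0≤s i)))
    split (yes (here i≡x)) = ℚ.≤-trans (p≤p+q (indicator-nonNeg (i ∈? l) (0≤s i)))
      (ℚ.+-monoˡ-≤ (indicator (i ∈? l) (s i)) (ℚ.≤-reflexive (sym (indicator-yes (i Fin.≟ x) {s i} i≡x))))
    split (yes (there i∈l)) = ℚ.≤-trans (p≤q+p (indicator-nonNeg (i Fin.≟ x) (0≤s i)))
      (ℚ.+-monoʳ-≤ (indicator (i Fin.≟ x) (s i)) (ℚ.≤-reflexive (sym (indicator-yes (i ∈? l) {s i} i∈l))))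

Σ-indicator-injective≤1 : ∀ {n} m (i : Fin n) (g : Fin m → Fin n) → Injective _≡_ _≡_ g →
                          Σ[ m ] (λ j → indicator (i Fin.≟ g j) 1ℚ) ≤ 1ℚ
Σ-indicator-injective≤1 zero    i g g-inj = 0≤1
Σ-indicator-injective≤1 (suc m) i g g-inj =
  ℚ.≤-trans (ℚ.≤-reflexive (Σ-suc m (λ j → indicator (i Fin.≟ g j) 1ℚ))) (split (i Fin.≟ g zero))
  where
  split : (d : Dec (i ≡ g zero)) →
          indicator d 1ℚ + Σ[ m ] (λ j → indicator (i Fin.≟ g (suc j)) 1ℚ) ≤ 1ℚ
  split (yes i≡g0) =
    ℚ.≤-reflexive (trans (cong (1ℚ +_) (sum-map-0 (allFin m) other≡0)) (ℚ.+-identityʳ 1ℚ))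
    where
    other≡0 : ∀ j → indicator (i Fin.≟ g (suc j)) 1ℚ ≡ 0ℚ
    other≡0 j = indicator-no (i Fin.≟ g (suc j)) {1ℚ}
                  (λ i≡gj → Fin.0≢1+n (g-inj (trans (sym i≡g0) i≡gj)))
  split (no _) = ℚ.≤-trans (ℚ.≤-reflexive (ℚ.+-identityˡ _))
                   (Σ-indicator-injective≤1 m i (g ∘ suc) (Fin.suc-injective ∘ g-inj))

lookup-injective : {A : Set} {xs : List A} → Unique xs → Injective _≡_ _≡_ (lookup xs)
lookup-injective {xs = x ∷ xs} (x∉xs ∷ u) {zero}  {zero}  _ = refl
lookup-injective {xs = x ∷ xs} (x∉xs ∷ u) {zero}  {suc b} e = ⊥-elim (All.lookup x∉xs (∈-lookup b) e)
lookup-injective {xs = x ∷ xs} (x∉xs ∷ u) {suc a} {zero}  e = ⊥-elim (All.lookup x∉xs (∈-lookup a) (sym e))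
lookup-injective {xs = x ∷ xs} (x∉xs ∷ u) {suc a} {suc b} e = cong suc (lookup-injective u e)

module RootedTree {n : ℕ} (parent : Fin n → Maybe (Fin n)) (r : Fin n)
                  (root-parent : parent r ≡ nothing) where

  distance : ∀ {i j} → Anc parent i j → ℕ
  distance here        = 0
  distance (there _ a) = suc (distance a)

  Anc-trans : ∀ {i j k} → Anc parent i j → Anc parent j k → Anc parent i k
  Anc-trans a here        = a
  Anc-trans a (there e b) = there e (Anc-trans a b)

  -- Parents are unique, so a chain ending at j is a prefix of the one from the root.
  distance≤depth : ∀ {i j} (a : Anc parent i j) (b : Anc parent r j) → distance a ℕ.≤ distance b
  distance≤depth here        b = z≤n
  distance≤depth (there e a) here with trans (sym root-parent) e
  ... | ()
  distance≤depth (there e a) (there e′ b) with trans (sym e) e′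
  ... | refl = s≤s (distance≤depth a b)

  depth-unique : ∀ {u v} (a : Anc parent r u) (b : Anc parent r v) → u ≡ v → distance a ≡ distance b
  depth-unique a b refl = ℕ.≤-antisym (distance≤depth a b) (distance≤depth b a)

  ancestorAt : ∀ {i j} (a : Anc parent i j) → Fin (suc (distance a)) → Fin n
  ancestorAt {j = j} a           zero    = j
  ancestorAt         (there _ a) (suc k) = ancestorAt a k

  suffix : ∀ {i j} (a : Anc parent i j) (k : Fin (suc (distance a))) →
           Σ (Anc parent i (ancestorAt a k)) (λ b → distance b ℕ.+ toℕ k ≡ distance a)
  suffix a           zero    = a , ℕ.+-identityʳ _
  suffix (there e a) (suc k) with suffix a k
  ... | b , eq = b , trans (ℕ.+-suc _ _) (cong suc eq)

  -- By pigeonhole a longer chain repeats a node, at two different depths.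
  depth<n : ∀ {j} (a : Anc parent r j) → distance a ℕ.< n
  depth<n a with distance a ℕ.<? n
  ... | yes a<n = a<n
  ... | no  a≮n with Fin.pigeonhole (s≤s (ℕ.≮⇒≥ a≮n)) (ancestorAt a)
  ... | p , q , p<q , same with suffix a p | suffix a q
  ... | b₁ , e₁ | b₂ , e₂ = ⊥-elim (ℕ.<-irrefl p≡q p<q)
    where
    p≡q : toℕ p ≡ toℕ q
    p≡q = ℕ.+-cancelˡ-≡ (distance b₁) _ _
      (trans (trans e₁ (sym e₂)) (cong (ℕ._+ toℕ q) (sym (depth-unique b₁ b₂ same))))

  Anc⇒∈pathFrom : ∀ {i j} (a : Anc parent i j) f → distance a ℕ.< f → i ∈ pathFrom parent f j
  Anc⇒∈pathFrom {j = j} here (suc f) _ with parent j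
  ... | nothing = here refl
  ... | just _  = here refl
  Anc⇒∈pathFrom (there e a) (suc f) (s≤s a<f) rewrite e = there (Anc⇒∈pathFrom a f a<f)

  -- Walk down through children; the depth bound makes the walk stop at a leaf.
  below-some-leaf : ∀ i → Anc parent r i → ∃ λ k → Leaf parent k × Anc parent i k
  below-some-leaf i a = go n i a (ℕ.m≤n+m n _)
    where
    go : (fuel : ℕ) (i : Fin n) (a : Anc parent r i) → n ℕ.≤ distance a ℕ.+ fuel →
         ∃ λ k → Leaf parent k × Anc parent i k
    go zero i a n≤d = ⊥-elim (ℕ.<-irrefl refl
      (ℕ.<-≤-trans (depth<n a) (ℕ.≤-trans n≤d (ℕ.≤-reflexive (ℕ.+-identityʳ _)))))
    go (suc fuel) i a n≤d with leaf? parent i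
    ... | yes i-leaf = i , i-leaf , here
    ... | no  ¬i-leaf
          with Fin.¬∀⟶∃¬ n _ (λ j → ¬? (≡-dec Fin._≟_ (parent j) (just i))) ¬i-leaf
    ... | j , ¬¬child = extend (go fuel j (there child a) (ℕ.≤-trans n≤d (ℕ.≤-reflexive (ℕ.+-suc _ fuel))))
      where
      child : parent j ≡ just i
      child = decidable-stable (≡-dec Fin._≟_ (parent j) (just i)) ¬¬child
      extend : (∃ λ k → Leaf parent k × Anc parent j k) → ∃ λ k → Leaf parent k × Anc parent i k
      extend (k , k-leaf , b) = k , k-leaf , Anc-trans (there child here) b

  on-some-leaf-path : (∀ j → Anc parent r j) → ∀ i → ∃ λ k → Leaf parent k × i ∈ Π parent k
  on-some-leaf-path r-anc i with below-some-leaf i (r-anc i)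
  ... | k , k-leaf , a =
    k , k-leaf , Anc⇒∈pathFrom a n (ℕ.≤-<-trans (distance≤depth a (r-anc k)) (depth<n (r-anc k)))

leaves : ∀ {n} → (Fin n → Maybe (Fin n)) → List (Fin n)
leaves {n} parent = filter (leaf? parent) (allFin n)

load : ∀ {n m} → (Fin n → Fin m → ℚ) → Fin n → ℚ
load {m = m} x i = Σ[ m ] (x i)

feasible⇒m≤numLeaves : ∀ {n m} (parent : Fin n → Maybe (Fin n)) (r : Fin n) →
                       IsRootedTree parent r → (x : Fin n → Fin m → ℚ) → Feasible parent x →
                       m ℕ.≤ numLeaves parent
feasible⇒m≤numLeaves {n} {m} parent r T x F = fromℕ-cancel-≤ (begin
  fromℕ m                                                 ≡⟨ sym (Σ-const-1 m) ⟩
  Σ[ m ] (λ _ → 1ℚ)                                       ≡⟨ sum-map-cong (allFin m) (sym ∘ task-once) ⟩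
  Σ[ m ] (λ j → Σ[ n ] (λ i → x i j))                     ≡⟨ sum-map-comm (allFin n) (allFin m) x ⟨
  Σ[ n ] (load x)                                         ≤⟨ sum-map-mono (allFin n) load≤Σ-leaves ⟩
  Σ[ n ] (λ i → sumℚ (map (λ k → onPath k i) (leaves parent)))
                                     ≡⟨ sum-map-comm (allFin n) (leaves parent) (λ i k → onPath k i) ⟩
  sumℚ (map (λ k → Σ[ n ] (onPath k)) (leaves parent))    ≤⟨ sum-map-≤1 (leaves parent) _ onPath≤1 ⟩
  fromℕ (numLeaves parent)                                ∎)
  where
  open ℚ.≤-Reasoning
  open Feasible F
  open IsRootedTree T
  open RootedTree parent r root-parent

  0≤load : ∀ i → 0ℚ ≤ load x i
  0≤load i = sum-map-nonNeg (allFin m) (lower i)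

  onPath : Fin n → Fin n → ℚ
  onPath k i = indicator (i ∈? Π parent k) (load x i)

  load≤Σ-leaves : ∀ i → load x i ≤ sumℚ (map (λ k → onPath k i) (leaves parent))
  load≤Σ-leaves i with on-some-leaf-path reaches-root i
  ... | k , k-leaf , i∈Πk = ℚ.≤-trans
    (ℚ.≤-reflexive (sym (indicator-yes (i ∈? Π parent k) {load x i} i∈Πk)))
    (∈⇒≤-sum-map (λ k → onPath k i) (λ k → indicator-nonNeg (i ∈? Π parent k) (0≤load i))
                 (∈-filter⁺ (leaf? parent) (∈-allFin k) k-leaf))

  onPath≤1 : ∀ {k} → k ∈ leaves parent → Σ[ n ] (onPath k) ≤ 1ℚ
  onPath≤1 {k} k∈leaves = ℚ.≤-trans (Σ-indicator-∈≤sum-map n (load x) 0≤load (Π parent k))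
                                    (path-cap k (proj₂ (∈-filter⁻ (leaf? parent) {xs = allFin n} k∈leaves)))

assignment : ∀ {n m} → (Fin m → Fin n) → Fin n → Fin m → ℚ
assignment g i j = indicator (i Fin.≟ g j) 1ℚ

module _ {n m : ℕ} (parent : Fin n → Maybe (Fin n)) (g : Fin m → Fin n)
         (g-injective : Injective _≡_ _≡_ g) (g-leaf : ∀ j → Leaf parent (g j)) where

  private
    x = assignment g

  load≤1 : ∀ i → load x i ≤ 1ℚ
  load≤1 i = Σ-indicator-injective≤1 m i g g-injective

  load-nonLeaf : ∀ q → ¬ Leaf parent q → load x q ≡ 0ℚ
  load-nonLeaf q ¬q-leaf = sum-map-0 (allFin m)
    (λ j → indicator-no (q Fin.≟ g j) {1ℚ} (λ q≡gj → ¬q-leaf (subst (Leaf parent) (sym q≡gj) (g-leaf j))))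

  -- Every node above q has a child, so is not a leaf.
  load-pathFrom-nonLeaf : ∀ f q → ¬ Leaf parent q → sumℚ (map (load x) (pathFrom parent f q)) ≡ 0ℚ
  load-pathFrom-nonLeaf zero    q ¬q-leaf = refl
  load-pathFrom-nonLeaf (suc f) q ¬q-leaf with parent q in eq
  ... | nothing = trans (cong (_+ 0ℚ) (load-nonLeaf q ¬q-leaf)) (ℚ.+-identityʳ 0ℚ)
  ... | just p  = trans (cong₂ _+_ (load-nonLeaf q ¬q-leaf)
                                   (load-pathFrom-nonLeaf f p (λ p-leaf → p-leaf q eq)))
                        (ℚ.+-identityʳ 0ℚ)

  load-pathFrom≤1 : ∀ f k → sumℚ (map (load x) (pathFrom parent f k)) ≤ 1ℚ
  load-pathFrom≤1 zero    k = 0≤1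
  load-pathFrom≤1 (suc f) k with parent k in eq
  ... | nothing = ℚ.≤-trans (ℚ.≤-reflexive (ℚ.+-identityʳ (load x k))) (load≤1 k)
  ... | just p  = ℚ.≤-trans
    (ℚ.≤-reflexive (trans (cong (load x k +_) (load-pathFrom-nonLeaf f p (λ p-leaf → p-leaf k eq)))
                          (ℚ.+-identityʳ (load x k))))
    (load≤1 k)

  assignment-feasible : Feasible parent x
  assignment-feasible = record
    { node-cap  = load≤1
    ; task-once = λ j → Σ-indicator-≡ n (g j) (λ _ → 1ℚ)
    ; path-cap  = λ k _ → load-pathFrom≤1 n k
    ; lower     = λ i j → indicator-nonNeg (i Fin.≟ g j) 0≤1
    ; upper     = λ i j → indicator-≤ (i Fin.≟ g j) 0≤1
    }

leaf-injection : ∀ {n m} (parent : Fin n → Maybe (Fin n)) → m ℕ.≤ numLeaves parent →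
                 ∃ λ (g : Fin m → Fin n) → Injective _≡_ _≡_ g × (∀ j → Leaf parent (g j))
leaf-injection {n} parent m≤ℓ =
  g , (λ e → Fin.inject≤-injective m≤ℓ m≤ℓ _ _ (lookup-injective unique e)) , g-leaf
  where
  unique : Unique (leaves parent)
  unique = filter⁺ (leaf? parent) (allFin⁺ n)

  g : Fin _ → Fin n
  g j = lookup (leaves parent) (inject≤ j m≤ℓ)

  g-leaf : ∀ j → Leaf parent (g j)
  g-leaf j = proj₂ (∈-filter⁻ (leaf? parent) {xs = allFin n} (∈-lookup (inject≤ j m≤ℓ)))

lemma4 : (n m : ℕ) (parent : Fin n → Maybe (Fin n)) (r : Fin n)
         → IsRootedTree parent r
         → (w : Fin n → Fin m → ℚ)
         → (∃ λ (x : Fin n → Fin m → ℚ) → Feasible parent x) ⇔ (numLeaves parent ≥ m)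
lemma4 n m parent r T _ = mk⇔
  (λ { (x , F) → feasible⇒m≤numLeaves parent r T x F })
  (λ m≤ℓ → let (g , g-injective , g-leaf) = leaf-injection parent m≤ℓ
           in assignment g , assignment-feasible parent g g-injective g-leaf)
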